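{- Let $w$ be an OP word over the alphabet $2^{AP}$ with OPM $M$, $i$ a position of $w$, $\mathrm p\notin AP$ a fresh normal (non-structural) proposition, and $\psi,\theta$ POTL formulas over $AP$. Let $w'$ be the OP word over $2^{AP\cup\{\mathrm p\}}$ (with OPM $M'(a,b)=M(a\cap AP,b\cap AP)$) identical to $w$ except that $\mathrm p$ holds in the position $h<i$ such that $\chi(h,i)$ and $h\lessdot i$ (and nowhere else). Then $(w,i)\models\psi\,\mathcal U_H^\lessdot\,\theta$ if and only if $(w',i)\models\Upsilon(\psi,\theta)$, where $\Upsilon(\psi,\theta)=\gamma_L\land\Big((\chi_P^\lessdot\mathrm p\to\psi)\,\mathcal U_\chi^{\doteq\gtrdot}\,(\chi_P^\lessdot\mathrm p\land\theta)\Big)$ and $\gamma_L=\chi_P^\lessdot\big(\mathrm p\land\bigcirc^{\lessdot\doteq\gtrdot}(\Box\neg\mathrm p)\land\ominus^{\lessdot\doteq\gtrdot}(\boxminus\neg\mathrm p)\big)$, with $\Box\alpha=\neg(\top\,\mathcal U_\chi^{\lessdot\doteq\gtrdot}\,\neg\alpha)$ and $\boxminus\alpha=\neg(\top\,\mathcal S_\chi^{\lessdot\doteq\gtrdot}\,\neg\alpha)$.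
   Context: Let $AP$ be partitioned into normal propositions and structural labels, $\#\notin AP$ an end marker, $\Sigma=2^{AP}$. An operator precedence matrix (OPM) $M$ on $\Sigma$ is a partial function $M:(\Sigma\cup\{\#\})^2\to\{\lessdot,\doteq,\gtrdot\}$, defined only on sets containing exactly one structural label, depending only on structural labels. Write $a\,\pi\,b$ for $M(a,b)=\pi$; by convention $\#\lessdot b$ for every $b$ and $a\gtrdot\#$ for $a\in\Sigma$. A simple chain is $c_0c_1\dots c_\ell c_{\ell+1}$, $\ell\ge1$, $c_0,c_{\ell+1}\in\Sigma\cup\{\#\}$, $c_1..c_\ell\in\Sigma$, $c_0\lessdot c_1\doteq\dots\doteq c_\ell\gtrdot c_{\ell+1}$; a composed chain is $c_0s_0c_1\dots c_\ell s_\ell c_{\ell+1}$ with $c_0c_1\dots c_{\ell+1}$ simple and each $s_k$ empty or with $c_ks_kc_{k+1}$ a chain. $x\in\Sigma^*$ is compatible with $M$ if $M$ is defined on consecutive letters and on the context of every chain substring of $\#x\#$. An OP word is $w=\langle U,M,P\rangle$, $U=\{0,\dots,n+1\}$, $P(0)=P(n+1)=\#$, $P(1)\cdots P(n)$ compatible with $M$; $i\,\pi\,j$ means $P(i)\,\pi\,P(j)$; $\chi(i,j)$ iff $i<j-1$ and $P(i)\cdots P(j)$ is a chain. POTL over a proposition set: $\varphi::=a\mid\neg\varphi\mid\varphi\lor\varphi\mid\bigcirc^{\Pi}\varphi\mid\ominus^{\Pi}\varphi\mid\chi_F^{\Pi}\varphi\mid\chi_P^{\Pi}\varphi\mid\varphi\,\mathcal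 U_\chi^{\Pi}\,\varphi\mid\varphi\,\mathcal S_\chi^{\Pi}\,\varphi\mid\bigcirc_H^{\mu}\varphi\mid\ominus_H^{\mu}\varphi\mid\varphi\,\mathcal U_H^{\mu}\,\varphi\mid\varphi\,\mathcal S_H^{\mu}\,\varphi$, $\Pi\subseteq\{\lessdot,\doteq,\gtrdot\}$ nonempty, $\mu\in\{\lessdot,\gtrdot\}$; $\top,\land,\to$ usual. Semantics at $i$: $a$ iff $a\in P(i)$; Booleans usual. $\bigcirc^\Pi\varphi$: $i\,\pi\,(i+1)$, $\pi\in\Pi$, $\varphi$ at $i+1$. $\ominus^\Pi\varphi$: $(i-1)\,\pi\,i$, $\pi\in\Pi$, $\varphi$ at $i-1$. $\chi_F^\Pi\varphi$: some $j>i$ with $\chi(i,j)$, $i\,\pi\,j$ ($\pi\in\Pi$), $\varphi$ at $j$. $\chi_P^\Pi\varphi$: some $j<i$ with $\chi(j,i)$, $j\,\pi\,i$ ($\pi\in\Pi$), $\varphi$ at $j$. $\bigcirc_H^\lessdot\varphi$: some $h<i$ has $\chi(h,i)$, $h\lessdot i$, $\{k>i:\chi(h,k),h\lessdot k\}\ne\emptyset$, $\varphi$ at its minimum; $\ominus_H^\lessdot$: $\{k<i:\chi(h,k),h\lessdot k\}$, maximum; $\bigcirc_H^\gtrdot\varphi$: some $h>i$ has $\chi(i,h)$, $i\gtrdot h$, $\{k>i:\chi(k,h),k\gtrdot h\}\ne\emptyset$, $\varphi$ at its minimum; $\ominus_H^\gtrdot$: $\{k<i:\chi(k,h),k\gtrdot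 h\}$, maximum. A path from $i$ to $j$ is $i=i_1<\dots<i_n=j$. For a path set $\Gamma$: $\varphi\,\mathcal U_\Gamma\,\psi$ at $i$ iff for some $j\ge i$ a $\Gamma$-path from $i$ to $j$ has $\varphi$ at $i_1..i_{n-1}$ and $\psi$ at $i_n$; $\varphi\,\mathcal S_\Gamma\,\psi$ at $i$ iff for some $j\le i$ a $\Gamma$-path $j=i_1<\dots<i_n=i$ has $\psi$ at $i_1$ and $\varphi$ at $i_2..i_n$. Summary path for $\Pi$: for each $p<n$, if $K_p=\{h\le j:\chi(i_p,h),i_p\,\pi\,h,\pi\in\Pi\}\ne\emptyset$ then $i_{p+1}=\max K_p$, else $i_{p+1}=i_p+1$ with $i_p\,\pi\,(i_p+1)$ for some $\pi\in\Pi$ ($\mathcal U_\chi^\Pi,\mathcal S_\chi^\Pi$). Yield-precedence hierarchical path: some $h<i$ has $\chi(h,i_p)$, $h\lessdot i_p$ for all $p$, and no $k$ with $i_q<k<i_{q+1}$, $\chi(h,k)$ ($\mathcal U_H^\lessdot,\mathcal S_H^\lessdot$). Take-precedence hierarchical path: some $h>j$ has $\chi(i_p,h)$, $i_p\gtrdot h$ for all $p$, no $k$ with $i_q<k<i_{q+1}$, $\chi(k,h)$ ($\mathcal U_H^\gtrdot,\mathcal S_H^\gtrdot$). -}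

module Defs where

open import Data.Nat using (ℕ; zero; suc; _≤_; _<_; _≤ᵇ_; _≡ᵇ_)
open import Data.Bool using (Bool; true; false; if_then_else_)
open import Data.Maybe using (Maybe; just; nothing)
open import Data.Product using (Σ; ∃; _×_; _,_)
open import Data.Sum using (_⊎_; inj₁; inj₂)
open import Data.Unit using (⊤; tt)
open import Relation.Nullary using (¬_)
open import Relation.Binary.PropositionalEquality using (_≡_)

data Prec : Set where
  ⋖ ≐ ⋗ : Prec

-- Letters: subsets of the atomic propositions, as characteristic functions.
-- The atom type A plays the role of AP; isS : A → Bool marks the
-- structural labels (the remaining atoms are normal propositions).

Letter : Set → Set
Letter A = A → Bool

ExactlyOneStruct : {A : Set} → (A → Bool) → Letter A → Set
ExactlyOneStruct {A} isS s =
  Σ A λ x → isS x ≡ true × s x ≡ true × (∀ y → isS y ≡ true → s y ≡ true → y ≡ x)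

SameStruct : {A : Set} → (A → Bool) → Letter A → Letter A → Set
SameStruct isS s t = ∀ x → isS x ≡ true → s x ≡ t x

-- An OPM on Σ = 2^A (its entries involving # are fixed by convention, see extM).
record IsOPM {A : Set} (isS : A → Bool) (M : Letter A → Letter A → Maybe Prec) : Set where
  field
    definedOnlyOnOneStruct : ∀ a b π → M a b ≡ just π →
                             ExactlyOneStruct isS a × ExactlyOneStruct isS b
    dependsOnlyOnStruct : ∀ a a' b b' → SameStruct isS a a' → SameStruct isS b b' →
                          M a b ≡ M a' b'

-- Words: positions 0 .. n+1, P(0) = P(n+1) = #, P(1) .. P(n) letters.

record PreWord (A : Set) : Set where
  field
    M : Letter A → Letter A → Maybe Prec
    n : ℕ
    P : ℕ → Letter A      -- only P 1 .. P n are relevant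

data Sym (A : Set) : Set where
  # : Sym A
  ⌜_⌝ : Letter A → Sym A

module _ {A : Set} (w : PreWord A) where
  open PreWord w

  sym : ℕ → Maybe (Sym A)
  sym zero = just #
  sym (suc k) = if suc k ≤ᵇ n then just ⌜ P (suc k) ⌝
                else (if suc k ≡ᵇ suc n then just # else nothing)

  extM : Sym A → Sym A → Maybe Prec
  extM # _ = just ⋖
  extM ⌜ a ⌝ # = just ⋗
  extM ⌜ a ⌝ ⌜ b ⌝ = M a b

  prec : ℕ → ℕ → Maybe Prec
  prec i j with sym i | sym j
  ... | just x | just y = extM x y
  ... | _ | _ = nothing

  -- Chains, read on positions: Chain i j iff P(i) ... P(j) is a (simple or
  -- composed) chain c₀ s₀ c₁ ... c_ℓ s_ℓ c_{ℓ+1}, the cₖ sitting at positions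
  -- i = k₀ < k₁ < ... < k_{ℓ+1} = j, ℓ ≥ 1.
  -- Gap a b : sₖ between consecutive cₖ at a and b is empty or cₖ sₖ cₖ₊₁ is a chain.
  -- Tail a j : c_m ≐ ... ≐ c_ℓ ⋗ c_{ℓ+1} starting from c_m at a (m ≥ 1).
  mutual
    data Gap : ℕ → ℕ → Set where
      adj  : ∀ {a} → Gap a (suc a)
      nest : ∀ {a b} → Chain a b → Gap a b

    data Tail : ℕ → ℕ → Set where
      last : ∀ {a j} → Gap a j → prec a j ≡ just ⋗ → Tail a j
      step : ∀ {a b j} → Gap a b → prec a b ≡ just ≐ → Tail b j → Tail a j

    data Chain : ℕ → ℕ → Set where
      mk : ∀ {i k j} → Gap i k → prec i k ≡ just ⋖ → Tail k j → Chain i j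

  χ : ℕ → ℕ → Set
  χ i j = suc i < j × Chain i j

  Compatible : Set
  Compatible =
    (∀ k → 1 ≤ k → suc k ≤ n → ∃ λ π → M (P k) (P (suc k)) ≡ just π) ×
    (∀ i j → χ i j → ∃ λ π → prec i j ≡ just π)

record OPWord (A : Set) (isS : A → Bool) : Set where
  field
    pre    : PreWord A
    isOPM  : IsOPM isS (PreWord.M pre)
    compat : Compatible pre

⌊_⌋ : {A : Set} {isS : A → Bool} → OPWord A isS → PreWord A
⌊ w ⌋ = OPWord.pre w

record PSet : Set where
  field
    mem : Prec → Bool
    nonempty : ∃ λ π → mem π ≡ true

data HDir : Set where
  yieldH takeH : HDir     -- yieldH is μ = ⋖, takeH is μ = ⋗

data Formula (A : Set) : Set where
  atom  : A → Formula A
  ⊤f    : Formula A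
  ¬f    : Formula A → Formula A
  _∨f_  : Formula A → Formula A → Formula A
  _∧f_  : Formula A → Formula A → Formula A
  _⇒f_  : Formula A → Formula A → Formula A
  ○     : PSet → Formula A → Formula A
  ⊖     : PSet → Formula A → Formula A
  χF    : PSet → Formula A → Formula A
  χP    : PSet → Formula A → Formula A
  Uχ    : PSet → Formula A → Formula A → Formula A
  Sχ    : PSet → Formula A → Formula A → Formula A
  ○H    : HDir → Formula A → Formula A
  ⊖H    : HDir → Formula A → Formula A
  UH    : HDir → Formula A → Formula A → Formula A
  SH    : HDir → Formula A → Formula A → Formula A

mapF : {A B : Set} → (A → B) → Formula A → Formula B
mapF f (atom a) = atom (f a)
mapF f ⊤f = ⊤f
mapF f (¬f φ) = ¬f (mapF f φ)
mapF f (φ ∨f ψ) = mapF f φ ∨f mapF f ψ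
mapF f (φ ∧f ψ) = mapF f φ ∧f mapF f ψ
mapF f (φ ⇒f ψ) = mapF f φ ⇒f mapF f ψ
mapF f (○ Π φ) = ○ Π (mapF f φ)
mapF f (⊖ Π φ) = ⊖ Π (mapF f φ)
mapF f (χF Π φ) = χF Π (mapF f φ)
mapF f (χP Π φ) = χP Π (mapF f φ)
mapF f (Uχ Π φ ψ) = Uχ Π (mapF f φ) (mapF f ψ)
mapF f (Sχ Π φ ψ) = Sχ Π (mapF f φ) (mapF f ψ)
mapF f (○H μ φ) = ○H μ (mapF f φ)
mapF f (⊖H μ φ) = ⊖H μ (mapF f φ)
mapF f (UH μ φ ψ) = UH μ (mapF f φ) (mapF f ψ)
mapF f (SH μ φ ψ) = SH μ (mapF f φ) (mapF f ψ)

-- until-paths i = i₁ < ... < iₙ = j : Φ at i₁..iₙ₋₁, Ψ at iₙ  (UPath … j i)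
data UPath (Step : ℕ → ℕ → Set) (Φ Ψ : ℕ → Set) (j : ℕ) : ℕ → Set where
  stop : Ψ j → UPath Step Φ Ψ j j
  go   : ∀ {a b} → a < b → Φ a → Step a b → UPath Step Φ Ψ j b → UPath Step Φ Ψ j a

-- since-paths j = i₁ < ... < iₙ = i : Ψ at i₁, Φ at i₂..iₙ  (SPath … j i)
data SPath (Step : ℕ → ℕ → Set) (Φ Ψ : ℕ → Set) (j : ℕ) : ℕ → Set where
  start : Ψ j → SPath Step Φ Ψ j j
  ext   : ∀ {b c} → SPath Step Φ Ψ j b → b < c → Step b c → Φ c → SPath Step Φ Ψ j c

module _ {A : Set} (w : PreWord A) where

  InΠ : PSet → ℕ → ℕ → Set
  InΠ Π i j = ∃ λ π → prec w i j ≡ just π × PSet.mem Π π ≡ true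

  -- one step of a summary path for Π whose last position is e
  SumStep : PSet → ℕ → ℕ → ℕ → Set
  SumStep Π e a b =
    (b ≤ e × χ w a b × InΠ Π a b × (∀ h → h ≤ e → χ w a h → InΠ Π a h → h ≤ b))
    ⊎ ((∀ h → h ≤ e → χ w a h → ¬ InΠ Π a h) × b ≡ suc a × InΠ Π a (suc a))

  NodeY : ℕ → ℕ → Set
  NodeY h a = χ w h a × prec w h a ≡ just ⋖
  StepY : ℕ → ℕ → ℕ → Set
  StepY h a b = ∀ k → a < k → k < b → ¬ χ w h k
  NodeT : ℕ → ℕ → Set
  NodeT h a = χ w a h × prec w a h ≡ just ⋗
  StepT : ℕ → ℕ → ℕ → Set
  StepT h a b = ∀ k → a < k → k < b → ¬ χ w k h

  Node : HDir → ℕ → ℕ → Set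
  Node yieldH = NodeY
  Node takeH = NodeT
  HStep : HDir → ℕ → ℕ → ℕ → Set
  HStep yieldH = StepY
  HStep takeH = StepT

  Sat : Formula A → ℕ → Set
  Sat (atom a) i = 1 ≤ i × i ≤ PreWord.n w × PreWord.P w i a ≡ true
  Sat ⊤f i = ⊤
  Sat (¬f φ) i = ¬ Sat φ i
  Sat (φ ∨f ψ) i = Sat φ i ⊎ Sat ψ i
  Sat (φ ∧f ψ) i = Sat φ i × Sat ψ i
  Sat (φ ⇒f ψ) i = Sat φ i → Sat ψ i
  Sat (○ Π φ) i = InΠ Π i (suc i) × Sat φ (suc i)
  Sat (⊖ Π φ) i = ∃ λ j → suc j ≡ i × InΠ Π j i × Sat φ j
  Sat (χF Π φ) i = ∃ λ j → i < j × χ w i j × InΠ Π i j × Sat φ j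
  Sat (χP Π φ) i = ∃ λ j → j < i × χ w j i × InΠ Π j i × Sat φ j
  Sat (Uχ Π φ ψ) i = ∃ λ j → i ≤ j × UPath (SumStep Π j) (Sat φ) (Sat ψ) j i
  Sat (Sχ Π φ ψ) i = ∃ λ j → j ≤ i × SPath (SumStep Π i) (Sat φ) (Sat ψ) j i
  Sat (○H yieldH φ) i = ∃ λ h → ∃ λ k →
    h < i × χ w h i × prec w h i ≡ just ⋖ × i < k × χ w h k × prec w h k ≡ just ⋖ ×
    (∀ k' → i < k' → χ w h k' → prec w h k' ≡ just ⋖ → k ≤ k') × Sat φ k
  Sat (⊖H yieldH φ) i = ∃ λ h → ∃ λ k →
    h < i × χ w h i × prec w h i ≡ just ⋖ × k < i × χ w h k × prec w h k ≡ just ⋖ ×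
    (∀ k' → k' < i → χ w h k' → prec w h k' ≡ just ⋖ → k' ≤ k) × Sat φ k
  Sat (○H takeH φ) i = ∃ λ h → ∃ λ k →
    i < h × χ w i h × prec w i h ≡ just ⋗ × i < k × χ w k h × prec w k h ≡ just ⋗ ×
    (∀ k' → i < k' → χ w k' h → prec w k' h ≡ just ⋗ → k ≤ k') × Sat φ k
  Sat (⊖H takeH φ) i = ∃ λ h → ∃ λ k →
    i < h × χ w i h × prec w i h ≡ just ⋗ × k < i × χ w k h × prec w k h ≡ just ⋗ ×
    (∀ k' → k' < i → χ w k' h → prec w k' h ≡ just ⋗ → k' ≤ k) × Sat φ k
  Sat (UH μ φ ψ) i = ∃ λ j → i ≤ j × ∃ λ h →
    UPath (HStep μ h) (λ a → Node μ h a × Sat φ a) (λ a → Node μ h a × Sat ψ a) j i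
  Sat (SH μ φ ψ) i = ∃ λ j → j ≤ i × ∃ λ h →
    SPath (HStep μ h) (λ a → Node μ h a × Sat φ a) (λ a → Node μ h a × Sat ψ a) j i

Π⋖ : PSet
Π⋖ = record { mem = λ { ⋖ → true ; ≐ → false ; ⋗ → false } ; nonempty = ⋖ , Relation.Binary.PropositionalEquality.refl }

Π≐⋗ : PSet
Π≐⋗ = record { mem = λ { ⋖ → false ; ≐ → true ; ⋗ → true } ; nonempty = ≐ , Relation.Binary.PropositionalEquality.refl }

Π⋖≐⋗ : PSet
Π⋖≐⋗ = record { mem = λ _ → true ; nonempty = ⋖ , Relation.Binary.PropositionalEquality.refl }

-- Extension of AP by a fresh normal proposition p : AP ∪ {p} = A ⊎ ⊤

isS⁺ : {A : Set} → (A → Bool) → (A ⊎ ⊤ → Bool)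
isS⁺ isS (inj₁ a) = isS a
isS⁺ isS (inj₂ _) = false

pₐ : {A : Set} → A ⊎ ⊤
pₐ = inj₂ tt

restrict : {A : Set} → Letter (A ⊎ ⊤) → Letter A
restrict s a = s (inj₁ a)

embed : {A : Set} → Formula A → Formula (A ⊎ ⊤)
embed = mapF inj₁

□ : {A : Set} → Formula A → Formula A
□ α = ¬f (Uχ Π⋖≐⋗ ⊤f (¬f α))

⊟ : {A : Set} → Formula A → Formula A
⊟ α = ¬f (Sχ Π⋖≐⋗ ⊤f (¬f α))

γL : {A : Set} → Formula (A ⊎ ⊤)
γL = χP Π⋖ (atom pₐ ∧f (○ Π⋖≐⋗ (□ (¬f (atom pₐ))) ∧f ⊖ Π⋖≐⋗ (⊟ (¬f (atom pₐ)))))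

Υ : {A : Set} → Formula (A ⊎ ⊤) → Formula (A ⊎ ⊤) → Formula (A ⊎ ⊤)
Υ ψ θ = γL ∧f Uχ Π≐⋗ (χP Π⋖ (atom pₐ) ⇒f ψ) (χP Π⋖ (atom pₐ) ∧f θ)

module Submission where

-- The positions related to the same h by χ(h,·) and h ⋖ · (the
-- ⋖-children of h) all lie on the spine of the chain from h to the last of
-- them, and between two consecutive children a and b the spine is a tail
-- a ≐ … ≐ c ⋗ b whose steps are exactly the steps of a ≐⋗-summary path.
-- Hence hierarchical paths through children of h and ≐⋗-summary paths
-- carrying χ_P^⋖ p at their checkpoints correspond to each other, while γ_L
-- only records that p holds at exactly one position, a ⋖-parent of i.

open import Defs hiding (sym)
open import Data.Nat using (ℕ; zero; suc; _≤_; _<_; _+_; _<ᵇ_; _≡ᵇ_; z≤n; s≤s; _≤?_)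
open import Data.Nat.Properties
open import Data.Bool using (Bool; true; false; T; if_then_else_)
open import Data.Maybe using (Maybe; just; nothing)
open import Data.Product using (∃; _×_; _,_; proj₁; proj₂)
open import Data.Sum using (_⊎_; inj₁; inj₂; [_,_]′)
open import Data.Unit using (⊤; tt)
open import Data.Empty using (⊥; ⊥-elim)
open import Function.Base using (_∘_)
open import Function.Bundles using (_⇔_; mk⇔; Equivalence)
open import Relation.Nullary using (¬_; yes; no)
open import Relation.Binary.Definitions using (tri<; tri≈; tri>)
open import Relation.Binary.PropositionalEquality using (_≡_; refl; sym; trans; subst)

⋖≢⋗ : ∀ {m : Maybe Prec} → m ≡ just ⋖ → m ≡ just ⋗ → ⊥
⋖≢⋗ refl ()

⋖≢≐ : ∀ {m : Maybe Prec} → m ≡ just ⋖ → m ≡ just ≐ → ⊥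
⋖≢≐ refl ()

≐≢⋗ : ∀ {m : Maybe Prec} → m ≡ just ≐ → m ≡ just ⋗ → ⊥
≐≢⋗ refl ()

module ChainGeometry {A : Set} (W : PreWord A) where

  mutual
    gap-< : ∀ {a b} → Gap W a b → a < b
    gap-< adj = n<1+n _
    gap-< (nest c) = <-trans (n<1+n _) (chain-< c)

    tail-< : ∀ {a b} → Tail W a b → a < b
    tail-< (last g _) = gap-< g
    tail-< (step g _ t) = <-trans (gap-< g) (tail-< t)

    chain-< : ∀ {a b} → Chain W a b → suc a < b
    chain-< (mk g _ t) = ≤-trans (s≤s (gap-< g)) (tail-< t)

  -- Descending through nested first gaps: the left end of a chain yields
  -- precedence to its right neighbour.
  chain-yields-next : ∀ {a b} → Chain W a b → prec W a (suc a) ≡ just ⋖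
  chain-yields-next (mk adj p _) = p
  chain-yields-next (mk (nest c) _ _) = chain-yields-next c

  -- Chains and gaps leaving a common position are nested.
  mutual
    nearer-gap-yields : ∀ {k c d} → Gap W k c → Gap W k d → c < d → prec W k c ≡ just ⋖
    nearer-gap-yields g adj lt = ⊥-elim (<⇒≱ lt (gap-< g))
    nearer-gap-yields adj (nest d) lt = chain-yields-next d
    nearer-gap-yields (nest c) (nest d) lt = nearer-chain-yields c d lt

    tails-end-together : ∀ {k a b} → Tail W k a → Tail W k b → a < b → ⊥
    tails-end-together (last g₁ p₁) (last g₂ p₂) lt with <-cmp _ _
    ... | tri< l _ _ = ⋖≢⋗ (nearer-gap-yields g₁ g₂ l) p₁
    ... | tri> _ _ l = ⋖≢⋗ (nearer-gap-yields g₂ g₁ l) p₂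
    ... | tri≈ _ refl _ = <-irrefl refl lt
    tails-end-together (last {j = c} g₁ p₁) (step {b = d} g₂ p₂ _) _ with <-cmp c d
    ... | tri< l _ _ = ⋖≢⋗ (nearer-gap-yields g₁ g₂ l) p₁
    ... | tri> _ _ l = ⋖≢≐ (nearer-gap-yields g₂ g₁ l) p₂
    ... | tri≈ _ refl _ = ≐≢⋗ p₂ p₁
    tails-end-together (step {b = c} g₁ p₁ _) (last {j = d} g₂ p₂) _ with <-cmp c d
    ... | tri< l _ _ = ⋖≢≐ (nearer-gap-yields g₁ g₂ l) p₁
    ... | tri> _ _ l = ⋖≢⋗ (nearer-gap-yields g₂ g₁ l) p₂
    ... | tri≈ _ refl _ = ≐≢⋗ p₁ p₂
    tails-end-together (step {b = c} g₁ p₁ t₁) (step {b = d} g₂ p₂ t₂) lt with <-cmp c d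
    ... | tri< l _ _ = ⋖≢≐ (nearer-gap-yields g₁ g₂ l) p₁
    ... | tri> _ _ l = ⋖≢≐ (nearer-gap-yields g₂ g₁ l) p₂
    ... | tri≈ _ refl _ = tails-end-together t₁ t₂ lt

    chain-within-first-gap : ∀ {x a k b} → Chain W x a → Gap W x k → Tail W k b → a < b → a ≤ k
    chain-within-first-gap {a = a} {k} (mk {k = k'} g' _ t') g t lt with a ≤? k
    ... | yes a≤k = a≤k
    ... | no a≰k with <-cmp k' k
    ...   | tri≈ _ refl _ = ⊥-elim (tails-end-together t' t lt)
    chain-within-first-gap (mk g' _ t') adj t lt | no a≰k | tri< l _ _ =
      ⊥-elim (<⇒≱ l (gap-< g'))
    chain-within-first-gap (mk g' _ t') (nest c) t lt | no a≰k | tri< l _ _ =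
      ⊥-elim (<⇒≱ l (chain-within-first-gap c g' t' (≰⇒> a≰k)))
    chain-within-first-gap (mk adj _ t') g t lt | no a≰k | tri> _ _ l =
      ⊥-elim (<⇒≱ l (gap-< g))
    chain-within-first-gap (mk (nest c') _ t') g t lt | no a≰k | tri> _ _ l =
      ⊥-elim (<⇒≱ l (chain-within-first-gap c' g t (<-trans (tail-< t') lt)))

    nearer-chain-yields : ∀ {x a b} → Chain W x a → Chain W x b → a < b → prec W x a ≡ just ⋖
    nearer-chain-yields c (mk g p t) lt with m≤n⇒m<n∨m≡n (chain-within-first-gap c g t lt)
    ... | inj₂ refl = p
    nearer-chain-yields c (mk adj _ _) lt | inj₁ l = ⊥-elim (<⇒≱ (chain-< c) (<⇒≤ l))
    nearer-chain-yields c (mk (nest d) _ _) lt | inj₁ l = nearer-chain-yields c d l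

  next-spine-position : ∀ {h x j} → Chain W h x → Chain W h j → x < j →
                        ∃ λ b → x < b × b ≤ j × Tail W x b
  next-spine-position c (mk g p t) lt with m≤n⇒m<n∨m≡n (chain-within-first-gap c g t lt)
  ... | inj₂ refl = _ , lt , ≤-refl , t
  next-spine-position c (mk adj _ _) lt | inj₁ l = ⊥-elim (<⇒≱ (chain-< c) (<⇒≤ l))
  next-spine-position c (mk (nest d) _ t) lt | inj₁ l with next-spine-position c d l
  ... | b , x<b , b≤ , tail = b , x<b , ≤-trans b≤ (<⇒≤ (tail-< t)) , tail

  consecutive-ends-tail : ∀ {h a b} → Chain W h a → Chain W h b → a < b →
                          (∀ k → a < k → k < b → ¬ χ W h k) → Tail W a b
  consecutive-ends-tail c (mk g p t) lt none with m≤n⇒m<n∨m≡n (chain-within-first-gap c g t lt)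
  ... | inj₂ refl = t
  consecutive-ends-tail c (mk adj _ _) lt none | inj₁ l = ⊥-elim (<⇒≱ (chain-< c) (<⇒≤ l))
  consecutive-ends-tail c (mk (nest d) _ t) lt none | inj₁ l = ⊥-elim (none _ l (tail-< t) (chain-< d , d))

  next-child : ∀ {h x j} → NodeY W h x → NodeY W h j → x < j →
               ∃ λ b → x < b × b ≤ j × Tail W x b × NodeY W h b × StepY W h x b
  next-child {h} {x} ((_ , cx) , h⋖x) ((_ , cj) , h⋖j) x<j with next-spine-position cx cj x<j
  ... | b , x<b , b≤j , tail = b , x<b , b≤j , tail , b-child , no-child-between
    where
    cb : Chain W h b
    cb = mk (nest cx) h⋖x tail

    b-child : NodeY W h b
    b-child with m≤n⇒m<n∨m≡n b≤j
    ... | inj₁ b<j = (chain-< cb , cb) , nearer-chain-yields cb cj b<j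
    ... | inj₂ refl = (chain-< cb , cb) , h⋖j

    no-child-between : StepY W h x b
    no-child-between m x<m m<b (_ , cm) = <⇒≱ x<m (chain-within-first-gap cm (nest cx) tail m<b)

  -- Facts about chains with a common right end mirror
  -- the facts above; they are proved on a grammar that builds a chain from
  -- its right end (every chain has such a reading, chain→rchain): Prefix x c reads x ⋖ c₁ ≐ … ≐ c (with gaps),
  -- and RChain x y closes a prefix ending at c by c ⋗ y.
  mutual
    data RGap : ℕ → ℕ → Set where
      adjʳ  : ∀ {a} → RGap a (suc a)
      nestʳ : ∀ {a b} → RChain a b → RGap a b

    data Prefix : ℕ → ℕ → Set where
      first  : ∀ {x c} → RGap x c → prec W x c ≡ just ⋖ → Prefix x c
      extend : ∀ {x c d} → Prefix x c → RGap c d → prec W c d ≡ just ≐ → Prefix x d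

    data RChain : ℕ → ℕ → Set where
      close : ∀ {x c y} → Prefix x c → RGap c y → prec W c y ≡ just ⋗ → RChain x y

  mutual
    gap→rgap : ∀ {a b} → Gap W a b → RGap a b
    gap→rgap adj = adjʳ
    gap→rgap (nest c) = nestʳ (chain→rchain c)

    chain→rchain : ∀ {a b} → Chain W a b → RChain a b
    chain→rchain (mk g p t) = close-tail (first (gap→rgap g) p) t

    close-tail : ∀ {x c y} → Prefix x c → Tail W c y → RChain x y
    close-tail pre (last g p) = close pre (gap→rgap g) p
    close-tail pre (step g p t) = close-tail (extend pre (gap→rgap g) p) t

  mutual
    rgap-< : ∀ {a b} → RGap a b → a < b
    rgap-< adjʳ = n<1+n _
    rgap-< (nestʳ c) = <-trans (n<1+n _) (rchain-< c)

    prefix-< : ∀ {a b} → Prefix a b → a < b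
    prefix-< (first g _) = rgap-< g
    prefix-< (extend pre g _) = <-trans (prefix-< pre) (rgap-< g)

    rchain-< : ∀ {a b} → RChain a b → suc a < b
    rchain-< (close pre g _) = ≤-trans (s≤s (prefix-< pre)) (rgap-< g)

  rchain-takes-previous : ∀ {a m} → RChain a (suc m) → prec W m (suc m) ≡ just ⋗
  rchain-takes-previous (close _ adjʳ p) = p
  rchain-takes-previous (close _ (nestʳ c) _) = rchain-takes-previous c

  mutual
    nearer-rgap-takes : ∀ {k c d} → RGap c k → RGap d k → c < d → prec W d k ≡ just ⋗
    nearer-rgap-takes adjʳ g lt = ⊥-elim (<⇒≱ lt (<⇒≤pred (rgap-< g)))
    nearer-rgap-takes (nestʳ c) adjʳ lt = rchain-takes-previous c
    nearer-rgap-takes (nestʳ c) (nestʳ d) lt = nearer-rchain-takes c d lt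

    prefixes-start-together : ∀ {a b c} → Prefix a c → Prefix b c → a < b → ⊥
    prefixes-start-together (first g₁ p₁) (first g₂ p₂) lt = ⋖≢⋗ p₂ (nearer-rgap-takes g₁ g₂ lt)
    prefixes-start-together (first {x = c} g₁ p₁) (extend {c = d} _ g₂ p₂) _ with <-cmp c d
    ... | tri< l _ _ = ≐≢⋗ p₂ (nearer-rgap-takes g₁ g₂ l)
    ... | tri> _ _ l = ⋖≢⋗ p₁ (nearer-rgap-takes g₂ g₁ l)
    ... | tri≈ _ refl _ = ⋖≢≐ p₁ p₂
    prefixes-start-together (extend {c = c} _ g₁ p₁) (first {x = d} g₂ p₂) _ with <-cmp c d
    ... | tri< l _ _ = ⋖≢⋗ p₂ (nearer-rgap-takes g₁ g₂ l)
    ... | tri> _ _ l = ≐≢⋗ p₁ (nearer-rgap-takes g₂ g₁ l)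
    ... | tri≈ _ refl _ = ⋖≢≐ p₂ p₁
    prefixes-start-together (extend {c = c} pre₁ g₁ p₁) (extend {c = d} pre₂ g₂ p₂) lt with <-cmp c d
    ... | tri< l _ _ = ≐≢⋗ p₂ (nearer-rgap-takes g₁ g₂ l)
    ... | tri> _ _ l = ≐≢⋗ p₁ (nearer-rgap-takes g₂ g₁ l)
    ... | tri≈ _ refl _ = prefixes-start-together pre₁ pre₂ lt

    rchain-within-last-gap : ∀ {a b c y} → RChain b y → Prefix a c → RGap c y → a < b → c ≤ b
    rchain-within-last-gap {b = b} {c} (close {c = c'} pre' g' _) pre g lt with c ≤? b
    ... | yes c≤b = c≤b
    ... | no c≰b with <-cmp c c'
    ...   | tri≈ _ refl _ = ⊥-elim (prefixes-start-together pre pre' lt)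
    rchain-within-last-gap (close pre' g' _) pre adjʳ lt | no c≰b | tri< l _ _ =
      ⊥-elim (<⇒≱ l (<⇒≤pred (rgap-< g')))
    rchain-within-last-gap (close pre' g' _) pre (nestʳ ch) lt | no c≰b | tri< l _ _ =
      ⊥-elim (<⇒≱ l (rchain-within-last-gap ch pre' g' (≰⇒> c≰b)))
    rchain-within-last-gap (close pre' adjʳ _) pre g lt | no c≰b | tri> _ _ l =
      ⊥-elim (<⇒≱ l (<⇒≤pred (rgap-< g)))
    rchain-within-last-gap (close pre' (nestʳ ch') _) pre g lt | no c≰b | tri> _ _ l =
      ⊥-elim (<⇒≱ l (rchain-within-last-gap ch' pre g (<-trans lt (prefix-< pre'))))

    nearer-rchain-takes : ∀ {a b y} → RChain a y → RChain b y → a < b → prec W b y ≡ just ⋗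
    nearer-rchain-takes (close pre g p) c lt with m≤n⇒m<n∨m≡n (rchain-within-last-gap c pre g lt)
    ... | inj₂ refl = p
    nearer-rchain-takes (close pre adjʳ _) c lt | inj₁ l = ⊥-elim (<⇒≱ (rchain-< c) (s≤s (<⇒≤ l)))
    nearer-rchain-takes (close pre (nestʳ d) _) c lt | inj₁ l = nearer-rchain-takes d c l

  -- A position has at most one ⋖-parent: if χ(h,i), h ⋖ i and χ(h′,i),
  -- h′ ⋖ i, then h = h′, since otherwise the nearer one would take
  -- precedence over i.
  yield-parent-unique : ∀ {h h' i} → χ W h i → prec W h i ≡ just ⋖ →
                        χ W h' i → prec W h' i ≡ just ⋖ → h ≡ h'
  yield-parent-unique {h} {h'} (_ , c) p (_ , c') p' with <-cmp h h'
  ... | tri≈ _ e _ = e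
  ... | tri< l _ _ = ⊥-elim (⋖≢⋗ p' (nearer-rchain-takes (chain→rchain c) (chain→rchain c') l))
  ... | tri> _ _ l = ⊥-elim (⋖≢⋗ p (nearer-rchain-takes (chain→rchain c') (chain→rchain c) l))

module _ {Step : ℕ → ℕ → Set} {Φ Ψ : ℕ → Set} where

  upath-≤ : ∀ {j x} → UPath Step Φ Ψ j x → x ≤ j
  upath-≤ (stop _) = ≤-refl
  upath-≤ (go l _ _ rest) = <⇒≤ (<-≤-trans l (upath-≤ rest))

  upath-end : ∀ {j x} → UPath Step Φ Ψ j x → Ψ j
  upath-end (stop ψ) = ψ
  upath-end (go _ _ _ rest) = upath-end rest

  upath-start : ∀ {j x} → UPath Step Φ Ψ j x → Φ x ⊎ Ψ x
  upath-start (stop ψ) = inj₂ ψ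
  upath-start (go _ φ _ _) = inj₁ φ

  spath-start : ∀ {j x} → SPath Step Φ Ψ j x → Ψ j
  spath-start (start ψ) = ψ
  spath-start (ext rest _ _ _) = spath-start rest

module _ {S₁ S₂ : ℕ → ℕ → Set} {Φ₁ Φ₂ Ψ₁ Ψ₂ : ℕ → Set}
         (step : ∀ a b → S₁ a b → S₂ a b) (φ : ∀ a → Φ₁ a → Φ₂ a) (ψ : ∀ a → Ψ₁ a → Ψ₂ a) where

  upath-map : ∀ {j x} → UPath S₁ Φ₁ Ψ₁ j x → UPath S₂ Φ₂ Ψ₂ j x
  upath-map (stop s) = stop (ψ _ s)
  upath-map (go l s st rest) = go l (φ _ s) (step _ _ st) (upath-map rest)

  spath-map : ∀ {j x} → SPath S₁ Φ₁ Ψ₁ j x → SPath S₂ Φ₂ Ψ₂ j x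
  spath-map (start s) = start (ψ _ s)
  spath-map (ext rest l st s) = ext (spath-map rest) l (step _ _ st) (φ _ s)

-- Chains are defined from precedences alone, so they transfer between words
-- with the same precedences.
module ChainTransfer {A B : Set} (W₁ : PreWord A) (W₂ : PreWord B)
    (same-prec : ∀ x y → prec W₁ x y ≡ prec W₂ x y) where

  prec-transfer : ∀ x y {v} → prec W₁ x y ≡ v → prec W₂ x y ≡ v
  prec-transfer x y e = trans (sym (same-prec x y)) e

  mutual
    gap-transfer : ∀ {a b} → Gap W₁ a b → Gap W₂ a b
    gap-transfer adj = adj
    gap-transfer (nest c) = nest (chain-transfer c)

    tail-transfer : ∀ {a b} → Tail W₁ a b → Tail W₂ a b
    tail-transfer (last {a} {j} g p) = last (gap-transfer g) (prec-transfer a j p)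
    tail-transfer (step {a} {b} g p t) = step (gap-transfer g) (prec-transfer a b p) (tail-transfer t)

    chain-transfer : ∀ {a b} → Chain W₁ a b → Chain W₂ a b
    chain-transfer (mk {i} {k} g p t) = mk (gap-transfer g) (prec-transfer i k p) (tail-transfer t)

  χ-transfer : ∀ {x y} → χ W₁ x y → χ W₂ x y
  χ-transfer (l , c) = l , chain-transfer c

  InΠ-transfer : ∀ Π x y → InΠ W₁ Π x y → InΠ W₂ Π x y
  InΠ-transfer Π x y (π , e , m) = π , prec-transfer x y e , m

-- Every operator reads
-- the word only through precedences, chains and atoms.
module SatTransfer {A B : Set} (f : A → B) (W₁ : PreWord A) (W₂ : PreWord B)
    (same-prec : ∀ x y → prec W₁ x y ≡ prec W₂ x y)
    (same-length : PreWord.n W₂ ≡ PreWord.n W₁)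
    (same-atoms : ∀ k → 1 ≤ k → k ≤ PreWord.n W₁ → ∀ a → PreWord.P W₂ k (f a) ≡ PreWord.P W₁ k a) where

  open ChainTransfer W₁ W₂ same-prec
    renaming (prec-transfer to prec⇒; χ-transfer to χ⇒; InΠ-transfer to InΠ⇒)
  open ChainTransfer W₂ W₁ (λ x y → sym (same-prec x y))
    renaming (prec-transfer to prec⇐; χ-transfer to χ⇐; InΠ-transfer to InΠ⇐)

  SumStep⇒ : ∀ Π e a b → SumStep W₁ Π e a b → SumStep W₂ Π e a b
  SumStep⇒ Π e a b (inj₁ (le , c , r , maximal)) =
    inj₁ (le , χ⇒ c , InΠ⇒ Π a b r , λ h le' c' r' → maximal h le' (χ⇐ c') (InΠ⇐ Π a h r'))
  SumStep⇒ Π e a b (inj₂ (none , eq , r)) =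
    inj₂ ((λ h le c' r' → none h le (χ⇐ c') (InΠ⇐ Π a h r')) , eq , InΠ⇒ Π a (suc a) r)

  SumStep⇐ : ∀ Π e a b → SumStep W₂ Π e a b → SumStep W₁ Π e a b
  SumStep⇐ Π e a b (inj₁ (le , c , r , maximal)) =
    inj₁ (le , χ⇐ c , InΠ⇐ Π a b r , λ h le' c' r' → maximal h le' (χ⇒ c') (InΠ⇒ Π a h r'))
  SumStep⇐ Π e a b (inj₂ (none , eq , r)) =
    inj₂ ((λ h le c' r' → none h le (χ⇒ c') (InΠ⇒ Π a h r')) , eq , InΠ⇐ Π a (suc a) r)

  Node⇒ : ∀ μ h a → Node W₁ μ h a → Node W₂ μ h a
  Node⇒ yieldH h a (c , p) = χ⇒ c , prec⇒ h a p
  Node⇒ takeH h a (c , p) = χ⇒ c , prec⇒ a h p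

  Node⇐ : ∀ μ h a → Node W₂ μ h a → Node W₁ μ h a
  Node⇐ yieldH h a (c , p) = χ⇐ c , prec⇐ h a p
  Node⇐ takeH h a (c , p) = χ⇐ c , prec⇐ a h p

  HStep⇒ : ∀ μ h a b → HStep W₁ μ h a b → HStep W₂ μ h a b
  HStep⇒ yieldH h a b s = λ k l₁ l₂ c → s k l₁ l₂ (χ⇐ c)
  HStep⇒ takeH h a b s = λ k l₁ l₂ c → s k l₁ l₂ (χ⇐ c)

  HStep⇐ : ∀ μ h a b → HStep W₂ μ h a b → HStep W₁ μ h a b
  HStep⇐ yieldH h a b s = λ k l₁ l₂ c → s k l₁ l₂ (χ⇒ c)
  HStep⇐ takeH h a b s = λ k l₁ l₂ c → s k l₁ l₂ (χ⇒ c)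

  -- Both directions at once, by induction on φ (negation and implication
  -- swap the direction).
  mutual
    sat⇒ : ∀ φ k → Sat W₁ φ k → Sat W₂ (mapF f φ) k
    sat⇒ (atom a) k (l₁ , l₂ , e) = l₁ , subst (k ≤_) (sym same-length) l₂ , trans (same-atoms k l₁ l₂ a) e
    sat⇒ ⊤f k s = s
    sat⇒ (¬f φ) k s = λ s' → s (sat⇐ φ k s')
    sat⇒ (φ ∨f ψ) k (inj₁ s) = inj₁ (sat⇒ φ k s)
    sat⇒ (φ ∨f ψ) k (inj₂ s) = inj₂ (sat⇒ ψ k s)
    sat⇒ (φ ∧f ψ) k (s , t) = sat⇒ φ k s , sat⇒ ψ k t
    sat⇒ (φ ⇒f ψ) k s = λ s' → sat⇒ ψ k (s (sat⇐ φ k s'))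
    sat⇒ (○ Π φ) k (r , s) = InΠ⇒ Π k (suc k) r , sat⇒ φ _ s
    sat⇒ (⊖ Π φ) k (j , e , r , s) = j , e , InΠ⇒ Π j k r , sat⇒ φ j s
    sat⇒ (χF Π φ) k (j , l , c , r , s) = j , l , χ⇒ c , InΠ⇒ Π k j r , sat⇒ φ j s
    sat⇒ (χP Π φ) k (j , l , c , r , s) = j , l , χ⇒ c , InΠ⇒ Π j k r , sat⇒ φ j s
    sat⇒ (Uχ Π φ ψ) k (j , l , path) = j , l , upath-map (SumStep⇒ Π j) (sat⇒ φ) (sat⇒ ψ) path
    sat⇒ (Sχ Π φ ψ) k (j , l , path) = j , l , spath-map (SumStep⇒ Π k) (sat⇒ φ) (sat⇒ ψ) path
    sat⇒ (○H yieldH φ) k (h , k' , l₁ , c₁ , p₁ , l₂ , c₂ , p₂ , least , s) =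
      h , k' , l₁ , χ⇒ c₁ , prec⇒ h k p₁ , l₂ , χ⇒ c₂ , prec⇒ h k' p₂ ,
      (λ m l c p → least m l (χ⇐ c) (prec⇐ h m p)) , sat⇒ φ k' s
    sat⇒ (○H takeH φ) k (h , k' , l₁ , c₁ , p₁ , l₂ , c₂ , p₂ , least , s) =
      h , k' , l₁ , χ⇒ c₁ , prec⇒ k h p₁ , l₂ , χ⇒ c₂ , prec⇒ k' h p₂ ,
      (λ m l c p → least m l (χ⇐ c) (prec⇐ m h p)) , sat⇒ φ k' s
    sat⇒ (⊖H yieldH φ) k (h , k' , l₁ , c₁ , p₁ , l₂ , c₂ , p₂ , greatest , s) =
      h , k' , l₁ , χ⇒ c₁ , prec⇒ h k p₁ , l₂ , χ⇒ c₂ , prec⇒ h k' p₂ ,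
      (λ m l c p → greatest m l (χ⇐ c) (prec⇐ h m p)) , sat⇒ φ k' s
    sat⇒ (⊖H takeH φ) k (h , k' , l₁ , c₁ , p₁ , l₂ , c₂ , p₂ , greatest , s) =
      h , k' , l₁ , χ⇒ c₁ , prec⇒ k h p₁ , l₂ , χ⇒ c₂ , prec⇒ k' h p₂ ,
      (λ m l c p → greatest m l (χ⇐ c) (prec⇐ m h p)) , sat⇒ φ k' s
    sat⇒ (UH μ φ ψ) k (j , l , h , path) =
      j , l , h , upath-map (HStep⇒ μ h) (λ a (nd , s) → Node⇒ μ h a nd , sat⇒ φ a s)
                                         (λ a (nd , s) → Node⇒ μ h a nd , sat⇒ ψ a s) path
    sat⇒ (SH μ φ ψ) k (j , l , h , path) =
      j , l , h , spath-map (HStep⇒ μ h) (λ a (nd , s) → Node⇒ μ h a nd , sat⇒ φ a s)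
                                         (λ a (nd , s) → Node⇒ μ h a nd , sat⇒ ψ a s) path

    sat⇐ : ∀ φ k → Sat W₂ (mapF f φ) k → Sat W₁ φ k
    sat⇐ (atom a) k (l₁ , l₂ , e) = l₁ , l₂' , trans (sym (same-atoms k l₁ l₂' a)) e
      where l₂' = subst (k ≤_) same-length l₂
    sat⇐ ⊤f k s = s
    sat⇐ (¬f φ) k s = λ s' → s (sat⇒ φ k s')
    sat⇐ (φ ∨f ψ) k (inj₁ s) = inj₁ (sat⇐ φ k s)
    sat⇐ (φ ∨f ψ) k (inj₂ s) = inj₂ (sat⇐ ψ k s)
    sat⇐ (φ ∧f ψ) k (s , t) = sat⇐ φ k s , sat⇐ ψ k t
    sat⇐ (φ ⇒f ψ) k s = λ s' → sat⇐ ψ k (s (sat⇒ φ k s'))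
    sat⇐ (○ Π φ) k (r , s) = InΠ⇐ Π k (suc k) r , sat⇐ φ _ s
    sat⇐ (⊖ Π φ) k (j , e , r , s) = j , e , InΠ⇐ Π j k r , sat⇐ φ j s
    sat⇐ (χF Π φ) k (j , l , c , r , s) = j , l , χ⇐ c , InΠ⇐ Π k j r , sat⇐ φ j s
    sat⇐ (χP Π φ) k (j , l , c , r , s) = j , l , χ⇐ c , InΠ⇐ Π j k r , sat⇐ φ j s
    sat⇐ (Uχ Π φ ψ) k (j , l , path) = j , l , upath-map (SumStep⇐ Π j) (sat⇐ φ) (sat⇐ ψ) path
    sat⇐ (Sχ Π φ ψ) k (j , l , path) = j , l , spath-map (SumStep⇐ Π k) (sat⇐ φ) (sat⇐ ψ) path
    sat⇐ (○H yieldH φ) k (h , k' , l₁ , c₁ , p₁ , l₂ , c₂ , p₂ , least , s) =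
      h , k' , l₁ , χ⇐ c₁ , prec⇐ h k p₁ , l₂ , χ⇐ c₂ , prec⇐ h k' p₂ ,
      (λ m l c p → least m l (χ⇒ c) (prec⇒ h m p)) , sat⇐ φ k' s
    sat⇐ (○H takeH φ) k (h , k' , l₁ , c₁ , p₁ , l₂ , c₂ , p₂ , least , s) =
      h , k' , l₁ , χ⇐ c₁ , prec⇐ k h p₁ , l₂ , χ⇐ c₂ , prec⇐ k' h p₂ ,
      (λ m l c p → least m l (χ⇒ c) (prec⇒ m h p)) , sat⇐ φ k' s
    sat⇐ (⊖H yieldH φ) k (h , k' , l₁ , c₁ , p₁ , l₂ , c₂ , p₂ , greatest , s) =
      h , k' , l₁ , χ⇐ c₁ , prec⇐ h k p₁ , l₂ , χ⇐ c₂ , prec⇐ h k' p₂ ,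
      (λ m l c p → greatest m l (χ⇒ c) (prec⇒ h m p)) , sat⇐ φ k' s
    sat⇐ (⊖H takeH φ) k (h , k' , l₁ , c₁ , p₁ , l₂ , c₂ , p₂ , greatest , s) =
      h , k' , l₁ , χ⇐ c₁ , prec⇐ k h p₁ , l₂ , χ⇐ c₂ , prec⇐ k' h p₂ ,
      (λ m l c p → greatest m l (χ⇒ c) (prec⇒ m h p)) , sat⇐ φ k' s
    sat⇐ (UH μ φ ψ) k (j , l , h , path) =
      j , l , h , upath-map (HStep⇐ μ h) (λ a (nd , s) → Node⇐ μ h a nd , sat⇐ φ a s)
                                         (λ a (nd , s) → Node⇐ μ h a nd , sat⇐ ψ a s) path
    sat⇐ (SH μ φ ψ) k (j , l , h , path) =
      j , l , h , spath-map (HStep⇐ μ h) (λ a (nd , s) → Node⇐ μ h a nd , sat⇐ φ a s)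
                                         (λ a (nd , s) → Node⇐ μ h a nd , sat⇐ ψ a s) path

  sat-invariant : ∀ φ k → Sat W₁ φ k ⇔ Sat W₂ (mapF f φ) k
  sat-invariant φ k = mk⇔ (sat⇒ φ k) (sat⇐ φ k)

letter-symbol : ∀ {A} (W : PreWord A) k → 1 ≤ k → k ≤ PreWord.n W → Defs.sym W k ≡ just ⌜ PreWord.P W k ⌝
letter-symbol W (suc k) _ k≤n with k <ᵇ PreWord.n W in e
... | true = refl
... | false = ⊥-elim (subst T e (≤⇒≤ᵇ k≤n))

-- In an OP word, consecutive positions inside the word are related by the
-- OPM (position 0 by the convention # ⋖ b, the others by compatibility).
consecutive-related : ∀ {A isS} (w : OPWord A isS) k → suc k ≤ PreWord.n ⌊ w ⌋ →
                      ∃ λ π → prec ⌊ w ⌋ k (suc k) ≡ just π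
consecutive-related w zero 1≤n rewrite letter-symbol ⌊ w ⌋ 1 ≤-refl 1≤n = ⋖ , refl
consecutive-related w (suc k) k+2≤n
  rewrite letter-symbol ⌊ w ⌋ (suc k) (s≤s z≤n) (<⇒≤ k+2≤n)
        | letter-symbol ⌊ w ⌋ (suc (suc k)) (s≤s z≤n) k+2≤n
  = proj₁ (OPWord.compat w) (suc k) (s≤s z≤n) k+2≤n

data SymAgree {A : Set} : Maybe (Sym A) → Maybe (Sym (A ⊎ ⊤)) → Set where
  outside : SymAgree nothing nothing
  marker  : SymAgree (just #) (just #)
  letter  : ∀ {a a'} → (∀ x → a' (inj₁ x) ≡ a x) → SymAgree (just ⌜ a ⌝) (just ⌜ a' ⌝)

end-or-outside : ∀ {A : Set} b → SymAgree {A} (if b then just # else nothing) (if b then just # else nothing)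
end-or-outside true = marker
end-or-outside false = outside

symbol-agree : ∀ {A : Set} (W : PreWord A) (W' : PreWord (A ⊎ ⊤)) →
  PreWord.n W' ≡ PreWord.n W →
  (∀ k → 1 ≤ k → k ≤ PreWord.n W → ∀ a → PreWord.P W' k (inj₁ a) ≡ PreWord.P W k a) →
  ∀ k → SymAgree (Defs.sym W k) (Defs.sym W' k)
symbol-agree W W' same-length same-atoms zero = marker
symbol-agree W W' same-length same-atoms (suc k) with PreWord.n W' | same-length
... | _ | refl with k <ᵇ PreWord.n W in e
...   | true = letter (same-atoms (suc k) (s≤s z≤n) (≤ᵇ⇒≤ (suc k) _ (subst T (sym e) tt)))
...   | false = end-or-outside (k ≡ᵇ PreWord.n W)

-- Hence w and w′ have the same precedences: M′ only reads a ∩ AP, and M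
-- only reads structural labels.
extension-same-prec : ∀ {A : Set} {isS : A → Bool} (w : OPWord A isS) (w' : OPWord (A ⊎ ⊤) (isS⁺ isS)) →
  PreWord.n ⌊ w' ⌋ ≡ PreWord.n ⌊ w ⌋ →
  (∀ a b → PreWord.M ⌊ w' ⌋ a b ≡ PreWord.M ⌊ w ⌋ (restrict a) (restrict b)) →
  (∀ k → 1 ≤ k → k ≤ PreWord.n ⌊ w ⌋ → ∀ a → PreWord.P ⌊ w' ⌋ k (inj₁ a) ≡ PreWord.P ⌊ w ⌋ k a) →
  ∀ x y → prec ⌊ w ⌋ x y ≡ prec ⌊ w' ⌋ x y
extension-same-prec w w' same-length same-M same-atoms x y
  with Defs.sym ⌊ w ⌋ x | Defs.sym ⌊ w' ⌋ x | symbol-agree ⌊ w ⌋ ⌊ w' ⌋ same-length same-atoms x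
     | Defs.sym ⌊ w ⌋ y | Defs.sym ⌊ w' ⌋ y | symbol-agree ⌊ w ⌋ ⌊ w' ⌋ same-length same-atoms y
... | _ | _ | outside | _ | _ | _ = refl
... | _ | _ | marker | _ | _ | outside = refl
... | _ | _ | marker | _ | _ | marker = refl
... | _ | _ | marker | _ | _ | letter _ = refl
... | _ | _ | letter _ | _ | _ | outside = refl
... | _ | _ | letter _ | _ | _ | marker = refl
... | _ | _ | letter {a} {a'} ea | _ | _ | letter {b} {b'} eb =
  sym (trans (same-M a' b')
             (IsOPM.dependsOnlyOnStruct (OPWord.isOPM w) _ a _ b (λ x _ → ea x) (λ x _ → eb x)))

module YieldUntil {A : Set} (W : PreWord (A ⊎ ⊤)) (i : ℕ)
    (p-marks-parent : ∀ k → Sat W (atom pₐ) k ⇔ (χ W k i × prec W k i ≡ just ⋖))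
    (consecutive : ∀ k → suc k ≤ PreWord.n W → ∃ λ π → prec W k (suc k) ≡ just π)
    (ψ θ : Formula (A ⊎ ⊤)) where

  open ChainGeometry W
  open Equivalence

  child-of-p : Formula (A ⊎ ⊤)
  child-of-p = χP Π⋖ (atom pₐ)

  SummaryPath : ℕ → ℕ → Set
  SummaryPath j x = UPath (SumStep W Π≐⋗ j) (Sat W (child-of-p ⇒f ψ)) (Sat W (child-of-p ∧f θ)) j x

  HierPath : ℕ → ℕ → ℕ → Set
  HierPath h j x = UPath (StepY W h) (λ a → NodeY W h a × Sat W ψ a) (λ a → NodeY W h a × Sat W θ a) j x

  hier-start-child : ∀ {h j x} → HierPath h j x → NodeY W h x
  hier-start-child path = [ proj₁ , proj₁ ]′ (upath-start path)

  p-only-at-parent : ∀ {h} → χ W h i → prec W h i ≡ just ⋖ → ∀ j → Sat W (atom pₐ) j → h ≡ j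
  p-only-at-parent χhi h⋖i j pj = let (χji , j⋖i) = to (p-marks-parent j) pj in
    yield-parent-unique χhi h⋖i χji j⋖i

  γL-holds : ∀ h → χ W h i → prec W h i ≡ just ⋖ → Sat W γL i
  γL-holds h χhi h⋖i with from (p-marks-parent h) (χhi , h⋖i)
  γL-holds (suc h) χhi h⋖i | ph@(_ , h<n , _) =
    suc h , <-trans (n<1+n _) (proj₁ χhi) , χhi , (⋖ , h⋖i , refl) , ph , no-p-after , no-p-before
    where
    no-p-after : Sat W (○ Π⋖≐⋗ (□ (¬f (atom pₐ)))) (suc h)
    no-p-after = (⋖ , chain-yields-next (proj₂ χhi) , refl) ,
      λ (j , h<j , path) → upath-end path (λ pj → <⇒≢ h<j (p-only-at-parent χhi h⋖i j pj))

    no-p-before : Sat W (⊖ Π⋖≐⋗ (⊟ (¬f (atom pₐ)))) (suc h)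
    no-p-before = let (π , e) = consecutive h h<n in h , refl , (π , e , refl) ,
      λ (j , j≤h , path) → spath-start path (λ pj → <⇒≱ (s≤s j≤h) (≤-reflexive (p-only-at-parent χhi h⋖i j pj)))

  ≐⋗-not-⋖ : ∀ {v : Maybe Prec} → (∃ λ π → v ≡ just π × PSet.mem Π≐⋗ π ≡ true) → v ≡ just ⋖ → ⊥
  ≐⋗-not-⋖ (⋖ , _ , ()) _
  ≐⋗-not-⋖ (≐ , e , _) q = ⋖≢≐ q e
  ≐⋗-not-⋖ (⋗ , e , _) q = ⋖≢⋗ q e

  -- A gap from c to c′ with c ≐ c′ or c ⋗ c′ is the step from c of every
  -- ≐⋗-summary path ending at or beyond c′: the chains from c are nested,
  -- so no chain from c with a ≐⋗ relation ends beyond c′ …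
  gap-summary-step : ∀ {c c' e} → Gap W c c' → InΠ W Π≐⋗ c c' → c' ≤ e → SumStep W Π≐⋗ e c c'
  gap-summary-step {c} {c'} (nest cc') r c'≤e = inj₁ (c'≤e , (chain-< cc' , cc') , r , maximal)
    where
    maximal : ∀ m → m ≤ _ → χ W c m → InΠ W Π≐⋗ c m → m ≤ c'
    maximal m _ (_ , cm) _ with m ≤? c'
    ... | yes m≤c' = m≤c'
    ... | no m≰c' = ⊥-elim (≐⋗-not-⋖ r (nearer-chain-yields cc' cm (≰⇒> m≰c')))
  gap-summary-step adj r _ = inj₂ ((λ m _ (_ , cm) _ → ≐⋗-not-⋖ r (chain-yields-next cm)) , refl , r)

  summary-step-unique : ∀ {c c' e x} → Gap W c c' → InΠ W Π≐⋗ c c' → c' ≤ e → SumStep W Π≐⋗ e c x → x ≡ c'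
  summary-step-unique {c} {c'} {e} {x} (nest cc') r c'≤e (inj₁ (_ , (_ , cx) , _ , maximal)) =
    ≤-antisym x≤c' (maximal c' c'≤e (chain-< cc' , cc') r)
    where
    x≤c' : x ≤ c'
    x≤c' with x ≤? c'
    ... | yes x≤c' = x≤c'
    ... | no x≰c' = ⊥-elim (≐⋗-not-⋖ r (nearer-chain-yields cc' cx (≰⇒> x≰c')))
  summary-step-unique (nest cc') r c'≤e (inj₂ (none , _ , _)) = ⊥-elim (none _ c'≤e (chain-< cc' , cc') r)
  summary-step-unique adj r _ (inj₁ (_ , (_ , cx) , _ , _)) = ⊥-elim (≐⋗-not-⋖ r (chain-yields-next cx))
  summary-step-unique adj r _ (inj₂ (_ , eq , _)) = eq

  tail-summary : ∀ {j c b} → Tail W c b → b ≤ j → Sat W (child-of-p ⇒f ψ) c →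
                 (∀ m → c < m → m < b → Sat W (child-of-p ⇒f ψ) m) → SummaryPath j b → SummaryPath j c
  tail-summary (last g p) b≤j φc _ rest = go (gap-< g) φc (gap-summary-step g (⋗ , p , refl) b≤j) rest
  tail-summary (step g p t) b≤j φc φinside rest =
    go (gap-< g) φc (gap-summary-step g (≐ , p , refl) (<⇒≤ (<-≤-trans (tail-< t) b≤j)))
       (tail-summary t b≤j (φinside _ (gap-< g) (tail-< t))
                     (λ m l₁ l₂ → φinside m (<-trans (gap-< g) l₁) l₂) rest)

  summary-through-tail : ∀ {j c b} → Tail W c b → b ≤ j → SummaryPath j c → SummaryPath j b
  summary-through-tail t b≤j (stop _) = ⊥-elim (<⇒≱ (tail-< t) b≤j)
  summary-through-tail (last g p) b≤j (go _ _ st rest) with summary-step-unique g (⋗ , p , refl) b≤j st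
  ... | refl = rest
  summary-through-tail (step g p t) b≤j (go _ _ st rest)
    with summary-step-unique g (≐ , p , refl) (<⇒≤ (<-≤-trans (tail-< t) b≤j)) st
  ... | refl = summary-through-tail t b≤j rest

  module WithParent (h : ℕ) (χhi : χ W h i) (h⋖i : prec W h i ≡ just ⋖) where

    -- by uniqueness of the parent, χ_P^⋖ p holds exactly at the ⋖-children of h
    child-of-p⇔child : ∀ k → Sat W child-of-p k ⇔ NodeY W h k
    child-of-p⇔child k = mk⇔ child parent-p
      where
      child : Sat W child-of-p k → NodeY W h k
      child (j , _ , χjk , (⋖ , e , _) , pj) with p-only-at-parent χhi h⋖i j pj
      ... | refl = χjk , e
      child (_ , _ , _ , (≐ , _ , ()) , _)
      child (_ , _ , _ , (⋗ , _ , ()) , _)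

      parent-p : NodeY W h k → Sat W child-of-p k
      parent-p (χhk , e) = h , <-trans (n<1+n h) (proj₁ χhk) , χhk , (⋖ , e , refl) , from (p-marks-parent h) (χhi , h⋖i)

    -- each hierarchical step between consecutive children is a tail, i.e. a
    -- run of summary steps whose inner positions are not children of h
    hier⇒summary : ∀ {j x} → HierPath h j x → SummaryPath j x
    hier⇒summary (stop (x-child , sθ)) = stop (from (child-of-p⇔child _) x-child , sθ)
    hier⇒summary (go x<y (x-child , sψ) no-child rest) =
      tail-summary (consecutive-ends-tail (proj₂ (proj₁ x-child)) (proj₂ (proj₁ (hier-start-child rest))) x<y no-child)
        (upath-≤ rest) (λ _ → sψ)
        (λ m l₁ l₂ s → ⊥-elim (no-child m l₁ l₂ (proj₁ (to (child-of-p⇔child m) s))))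
        (hier⇒summary rest)

    -- a summary path from a child x of h to a farther child j passes through
    -- the next child b, which is one hierarchical step; fuel bounds j − x
    summary⇒hier : ∀ {j x} (fuel : ℕ) → j ≤ x + fuel → NodeY W h x → SummaryPath j x → HierPath h j x
    summary⇒hier _ _ x-child (stop (_ , sθ)) = stop (x-child , sθ)
    summary⇒hier {j} {x} zero j≤x x-child (go x<y _ _ rest) =
      ⊥-elim (<⇒≱ (<-≤-trans x<y (upath-≤ rest)) (subst (j ≤_) (+-identityʳ x) j≤x))
    summary⇒hier {j} {x} (suc fuel) j≤x+fuel x-child path@(go x<y sφ _ rest)
      with next-child x-child (to (child-of-p⇔child j) (proj₁ (upath-end rest))) (<-≤-trans x<y (upath-≤ rest))
    ... | b , x<b , b≤j , tail , b-child , no-child =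
      go x<b (x-child , sφ (from (child-of-p⇔child x) x-child)) no-child
         (summary⇒hier fuel j≤b+fuel b-child (summary-through-tail tail b≤j path))
      where
      j≤b+fuel : j ≤ b + fuel
      j≤b+fuel = ≤-trans j≤x+fuel (subst (_≤ b + fuel) (sym (+-suc x fuel)) (+-monoˡ-≤ fuel x<b))

  yield-until⇔Υ : Sat W (UH yieldH ψ θ) i ⇔ Sat W (Υ ψ θ) i
  yield-until⇔Υ = mk⇔ forward backward
    where
    forward : Sat W (UH yieldH ψ θ) i → Sat W (Υ ψ θ) i
    forward (j , i≤j , h , path) =
      let (χhi , h⋖i) = hier-start-child path in
      γL-holds h χhi h⋖i , j , i≤j , WithParent.hier⇒summary h χhi h⋖i path

    backward : Sat W (Υ ψ θ) i → Sat W (UH yieldH ψ θ) i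
    backward ((h , _ , _ , _ , ph , _) , j , i≤j , path) =
      let (χhi , h⋖i) = to (p-marks-parent h) ph in
      j , i≤j , h , WithParent.summary⇒hier h χhi h⋖i j (m≤n+m j i) (χhi , h⋖i) path

-- Lemma 15.  Transport ψ U_H^⋖ θ from w to w′ (same precedences, atoms of
-- AP unchanged), restate the hypothesis on p in terms of w′, and apply the
-- core equivalence inside w′.
lemma15 : {A : Set} (isS : A → Bool)
    (w : OPWord A isS) (w' : OPWord (A ⊎ ⊤) (isS⁺ isS))
    (i : ℕ) → i ≤ suc (PreWord.n ⌊ w ⌋) →
    (ψ θ : Formula A) →
    PreWord.n ⌊ w' ⌋ ≡ PreWord.n ⌊ w ⌋ →
    (∀ a b → PreWord.M ⌊ w' ⌋ a b ≡ PreWord.M ⌊ w ⌋ (restrict a) (restrict b)) →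
    (∀ k → 1 ≤ k → k ≤ PreWord.n ⌊ w ⌋ → ∀ a → PreWord.P ⌊ w' ⌋ k (inj₁ a) ≡ PreWord.P ⌊ w ⌋ k a) →
    (∀ k → Sat ⌊ w' ⌋ (atom pₐ) k ⇔ (χ ⌊ w ⌋ k i × prec ⌊ w ⌋ k i ≡ just ⋖)) →
    Sat ⌊ w ⌋ (UH yieldH ψ θ) i ⇔ Sat ⌊ w' ⌋ (Υ (embed ψ) (embed θ)) i
lemma15 isS w w' i _ ψ θ same-length same-M same-atoms p-marks-parent =
  mk⇔ (to core ∘ to (sat-invariant (UH yieldH ψ θ) i))
      (from (sat-invariant (UH yieldH ψ θ) i) ∘ from core)
  where
  open Equivalence
  same-prec : ∀ x y → prec ⌊ w ⌋ x y ≡ prec ⌊ w' ⌋ x y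
  same-prec = extension-same-prec w w' same-length same-M same-atoms
  open SatTransfer inj₁ ⌊ w ⌋ ⌊ w' ⌋ same-prec same-length same-atoms using (sat-invariant)
  open ChainTransfer ⌊ w ⌋ ⌊ w' ⌋ same-prec using (χ-transfer; prec-transfer)
  open ChainTransfer ⌊ w' ⌋ ⌊ w ⌋ (λ x y → sym (same-prec x y))
    renaming (χ-transfer to χ-transfer⁻¹; prec-transfer to prec-transfer⁻¹)

  p-marks-parent′ : ∀ k → Sat ⌊ w' ⌋ (atom pₐ) k ⇔ (χ ⌊ w' ⌋ k i × prec ⌊ w' ⌋ k i ≡ just ⋖)
  p-marks-parent′ k = mk⇔ (λ pk → let (c , p) = to (p-marks-parent k) pk in χ-transfer c , prec-transfer k i p)
                         (λ (c , p) → from (p-marks-parent k) (χ-transfer⁻¹ c , prec-transfer⁻¹ k i p))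

  core : Sat ⌊ w' ⌋ (UH yieldH (embed ψ) (embed θ)) i ⇔ Sat ⌊ w' ⌋ (Υ (embed ψ) (embed θ)) i
  core = YieldUntil.yield-until⇔Υ ⌊ w' ⌋ i p-marks-parent′ (consecutive-related w') (embed ψ) (embed θ)
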